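{- For $s\ge1$ and $k\ge0$ let $P^s_k=p(+^s(-+^{s-1})^k+)$, and let $D_s$ be the directed graph obtained from the transitive tournament on $s+1$ vertices by deleting the edge from its source to its sink. Then for every $s\ge3$, $(\{P^s_k\mid k\ge0\},\{D_s\})$ is a duality pair, the family $\{P^s_k\mid k\ge 0\}$ is an antichain, and all the graphs $P^s_k$ ($k\ge0$) and $D_s$ are cores.
   Context: A (finite directed) graph is a pair $(V,E)$ with $V$ finite, $E\subseteq V^2$. A homomorphism $G\to H$ is a map $V(G)\to V(H)$ sending edges to edges; $G\to H$ means one exists. A core is a graph all of whose endomorphisms are isomorphisms. A family is an antichain if there is no homomorphism between any two distinct members. For a word $x=x_1\ldots x_k\in\{+,-\}^k$, $p(x)$ denotes the oriented path with vertices $w_0,\dots,w_k$, the $i$-th edge being $(w_{i-1},w_i)$ if $x_i=+$ and $(w_i,w_{i-1})$ if $x_i=-$; juxtaposition denotes concatenation and $y^k$ the concatenation of $k$ copies of $y$. The transitive tournament on vertices $v_0,\dots,v_s$ has edges $(v_i,v_j)$ for all $i<j$. A duality pair is a pair $(\mathcal{A},\mathcal{D})$ of families of graphs such that for every graph $G$ exactly one holds: $A\to G$ for some $A\in\mathcal{A}$, or $G\to D$ for some $D\in\mathcal{D}$. -}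

module Defs where

open import Data.Nat using (ℕ; zero; suc; _∸_; _<ᵇ_; _≡ᵇ_)
open import Data.Fin using (Fin; zero; suc; toℕ)
open import Data.Bool using (Bool; true; false; _∧_; not)
open import Data.List using (List; []; _∷_; length; replicate; concat; _++_)
open import Data.Product using (Σ; _×_)
open import Relation.Binary.PropositionalEquality using (_≡_)

record Graph : Set where
  field
    size : ℕ
    edge : Fin size → Fin size → Bool
open Graph public

V : Graph → Set
V G = Fin (size G)

E : (G : Graph) → V G → V G → Set
E G u v = edge G u v ≡ true

IsHom : (G H : Graph) → (V G → V H) → Set
IsHom G H f = ∀ u v → E G u v → E H (f u) (f v)

_⟶_ : Graph → Graph → Set
G ⟶ H = Σ (V G → V H) (IsHom G H)

IsIso : (G H : Graph) → (V G → V H) → Set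
IsIso G H f = Σ (V H → V G) λ g →
  (∀ x → g (f x) ≡ x) × (∀ y → f (g y) ≡ y) × IsHom H G g

IsCore : Graph → Set
IsCore G = ∀ (f : V G → V G) → IsHom G G f → IsIso G G f

data Sign : Set where
  plus minus : Sign

pathEdge : (x : List Sign) → Fin (suc (length x)) → Fin (suc (length x)) → Bool
pathEdge []            _       _       = false
pathEdge (plus ∷ xs)   zero    (suc zero) = true
pathEdge (minus ∷ xs)  (suc zero) zero = true
pathEdge (_ ∷ xs)      (suc i) (suc j) = pathEdge xs i j
pathEdge (_ ∷ _)       _       _       = false

p : List Sign → Graph
p x = record { size = suc (length x) ; edge = pathEdge x }

P : ℕ → ℕ → Graph
P s k = p (replicate s plus ++ concat (replicate k (minus ∷ replicate (s ∸ 1) plus)) ++ (plus ∷ []))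

D : ℕ → Graph
D s = record
  { size = suc s
  ; edge = λ i j → (toℕ i <ᵇ toℕ j) ∧ not ((toℕ i ≡ᵇ 0) ∧ (toℕ j ≡ᵇ s))
  }

-- A homomorphism G → D s must send the end of every walk along +^s (−+^{s−1})^k to the top
-- vertex s: s forward steps reach s, and since the edge (0, s) is missing each block steps back
-- to a vertex ≥ 1 and climbs back to s. So P^s_k ↛ D_s, and if G ↛ D_s the least set of such
-- forced vertices, computed as a fixpoint, contains one with an out-neighbour, giving P^s_k → G;
-- otherwise the forced vertices go to s and every other vertex to the largest level j ≤ s − 1
-- that it is forced to reach. Deleting either end of P^s_l leaves a graph that maps to D_s, so
-- a homomorphism P^s_k → P^s_l hits both ends of P^s_l; positions along a path move by at most
-- one per edge, hence P^s_l is not longer than P^s_k, and an endomorphism is the identity. For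
-- k > l, the net height s + k(s − 2) + 1 of P^s_k exceeds that of P^s_l.
module Submission where

open import Defs
open import Data.Nat using (ℕ; _≤_)
open import Data.Product using (Σ; _×_)
open import Data.Sum using (_⊎_)
open import Relation.Nullary using (¬_)
open import Relation.Binary.PropositionalEquality using (_≡_)

open import Data.Bool using (true)
import Data.Bool as Bool
open import Data.Empty using (⊥-elim)
open import Data.Fin using (Fin; zero; suc; toℕ; fromℕ; fromℕ<)
import Data.Fin as Fin
open import Data.Fin.Properties using (toℕ<n; toℕ-fromℕ; toℕ-fromℕ<; toℕ-injective; any?)
open import Data.Fin.Subset using (Subset; _∈_; _⊆_; _⊃_; ⊥)
open import Data.Fin.Subset.Induction using (⊃-wellFounded)
open import Data.Fin.Subset.Properties using (_∈?_; _⊂?_; ∉⊥)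
open import Data.List using (List; []; _∷_; _++_; length; replicate; concat)
open import Data.List.Properties using (length-++; ++-assoc; ++-identityʳ)
open import Data.Nat using (zero; suc; pred; _+_; _*_; _∸_; ∣_-_∣; _<_; z≤n; s≤s; _≟_; _<?_; _≤?_)
open import Data.Nat.Properties
open import Data.Product using (∃; _,_; proj₁; proj₂)
import Data.Product as Prod
open import Data.Sum using (inj₁; inj₂)
import Data.Sum as Sum
open import Data.Unit using (⊤; tt)
open import Data.Vec using (tabulate)
open import Data.Vec.Properties using (lookup∘tabulate; lookup⇒[]=; []=⇒lookup)
open import Function using (_∘_)
open import Induction.WellFounded using (Acc; acc)
open import Level using (0ℓ)
open import Relation.Binary using () renaming (Decidable to Decidable₂)
open import Relation.Binary.Definitions using (tri<; tri≈; tri>)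
open import Relation.Binary.PropositionalEquality
  using (_≢_; refl; sym; trans; cong; subst; subst₂; module ≡-Reasoning)
open import Relation.Nullary using (Dec; does; yes; no; ¬?; _×-dec_; _⊎-dec_)
open import Relation.Nullary.Decidable using (map′; dec-true; proof)
open import Relation.Nullary.Reflects using (Reflects; invert)
open import Relation.Unary using (Pred; Decidable; U)
open import Relation.Unary.Properties using (U?)

_∖_⟶_ : (G : Graph) → V G → Graph → Set
G ∖ z ⟶ H = Σ (V G → V H) λ g → ∀ a b → a ≢ z → b ≢ z → E G a b → E H (g a) (g b)

⟶-trans : ∀ {A B C} → A ⟶ B → B ⟶ C → A ⟶ C
⟶-trans (f , f-hom) (g , g-hom) = g ∘ f , λ a b e → g-hom (f a) (f b) (f-hom a b e)

≗id⇒isIso : ∀ {G} (f : V G → V G) → (∀ x → f x ≡ x) → IsIso G G f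
≗id⇒isIso f f≗id = (λ x → x) , f≗id , f≗id , λ _ _ e → e

⟶-hits : ∀ {A B H} (h : A ⟶ B) (z : V B) → B ∖ z ⟶ H → ¬ (A ⟶ H) →
         ∃ λ a → proj₁ h a ≡ z
⟶-hits (f , f-hom) z (g , g-hom) A↛H with any? (λ a → f a Fin.≟ z)
... | yes hit  = hit
... | no  miss = ⊥-elim (A↛H (g ∘ f , λ a b e → g-hom (f a) (f b)
                   (λ fa≡z → miss (a , fa≡z)) (λ fb≡z → miss (b , fb≡z)) (f-hom a b e)))

-- Oriented paths and walks

pathEdge-suc : ∀ c xs (i j : Fin (suc (length xs))) →
               pathEdge (c ∷ xs) (suc i) (suc j) ≡ pathEdge xs i j
pathEdge-suc plus  xs i             j       = refl
pathEdge-suc minus xs zero          zero    = refl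
pathEdge-suc minus xs zero          (suc j) = refl
pathEdge-suc minus xs (suc i)       zero    = refl
pathEdge-suc minus xs (suc i)       (suc j) = refl

pathEdge-adjacent : ∀ xs {a b : Fin (suc (length xs))} → E (p xs) a b →
                    toℕ b ≡ suc (toℕ a) ⊎ toℕ a ≡ suc (toℕ b)
pathEdge-adjacent (plus  ∷ xs) {zero}     {suc zero} _ = inj₁ refl
pathEdge-adjacent (minus ∷ xs) {suc zero} {zero}     _ = inj₂ refl
pathEdge-adjacent (c ∷ xs) {suc a} {suc b} e =
  Sum.map (cong suc) (cong suc) (pathEdge-adjacent xs (trans (sym (pathEdge-suc c xs a b)) e))

pathEdge-irrefl : ∀ xs {a} → ¬ E (p xs) a a
pathEdge-irrefl xs e = Sum.[ 1+n≢n ∘ sym , 1+n≢n ∘ sym ] (pathEdge-adjacent xs e)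

pathEdge-last : ∀ xs b → ¬ E (p (xs ++ plus ∷ [])) (fromℕ (length (xs ++ plus ∷ []))) b
pathEdge-last (plus  ∷ xs)     zero    ()
pathEdge-last (minus ∷ _ ∷ _)  zero    ()
pathEdge-last (c ∷ xs)         (suc b) e =
  pathEdge-last xs b (trans (sym (pathEdge-suc c (xs ++ plus ∷ []) _ b)) e)

Arc : (G : Graph) → Sign → V G → V G → Set
Arc G plus  u v = E G u v
Arc G minus u v = E G v u

data Walk (G : Graph) : V G → List Sign → V G → Set where
  []  : ∀ {u} → Walk G u [] u
  _∷_ : ∀ {c u v w xs} → Arc G c u v → Walk G v xs w → Walk G u (c ∷ xs) w

module _ {G : Graph} where

  _++ʷ_ : ∀ {u v w xs ys} → Walk G u xs v → Walk G v ys w → Walk G u (xs ++ ys) w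
  []      ++ʷ W′ = W′
  (a ∷ W) ++ʷ W′ = a ∷ (W ++ʷ W′)

  splitʷ : ∀ xs {ys u w} → Walk G u (xs ++ ys) w → ∃ λ v → Walk G u xs v × Walk G v ys w
  splitʷ []       W       = _ , [] , W
  splitʷ (c ∷ xs) (a ∷ W) with splitʷ xs W
  ... | v , W₁ , W₂ = v , a ∷ W₁ , W₂

  repeatʷ : ∀ {u xs} k → Walk G u xs u → Walk G u (concat (replicate k xs)) u
  repeatʷ zero    W = []
  repeatʷ (suc k) W = W ++ʷ repeatʷ k W

  snoc⁺ : ∀ {j u v w} → Walk G u (replicate j plus) v → E G v w → Walk G u (replicate (suc j) plus) w
  snoc⁺ {zero}  []      e = e ∷ []
  snoc⁺ {suc j} (a ∷ W) e = a ∷ snoc⁺ W e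

  -- The i-th vertex of a walk; indices past the end give the last vertex.
  vertexAt : ∀ {u xs w} → Walk G u xs w → ℕ → V G
  vertexAt {u} W       zero    = u
  vertexAt {u} []      (suc i) = u
  vertexAt     (a ∷ W) (suc i) = vertexAt W i

  walk-arc : ∀ {u xs w} (W : Walk G u xs w) i → i < length xs →
             ∃ λ c → Arc G c (vertexAt W i) (vertexAt W (suc i))
  walk-arc (a ∷ W) zero    _         = _ , a
  walk-arc (a ∷ W) (suc i) (s≤s i<n) = walk-arc W i i<n

  walk-isHom : ∀ {u xs w} (W : Walk G u xs w) → IsHom (p xs) G (vertexAt W ∘ toℕ)
  walk-isHom {xs = plus  ∷ _}  (a ∷ W) zero       (suc zero) _ = a
  walk-isHom {xs = minus ∷ _}  (a ∷ W) (suc zero) zero       _ = a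
  walk-isHom {xs = c ∷ xs}     (a ∷ W) (suc i)    (suc j)    e =
    walk-isHom W i j (trans (sym (pathEdge-suc c xs i j)) e)

  walk⇒⟶ : ∀ {u xs w} → Walk G u xs w → p xs ⟶ G
  walk⇒⟶ W = vertexAt W ∘ toℕ , walk-isHom W

  isHom-tail : ∀ c xs {f : V (p (c ∷ xs)) → V G} →
               IsHom (p (c ∷ xs)) G f → IsHom (p xs) G (f ∘ suc)
  isHom-tail c xs f-hom i j e = f-hom (suc i) (suc j) (trans (pathEdge-suc c xs i j) e)

  hom⇒walk : ∀ xs (f : V (p xs) → V G) → IsHom (p xs) G f →
             Walk G (f zero) xs (f (fromℕ (length xs)))
  hom⇒walk []           f f-hom = []
  hom⇒walk (plus  ∷ xs) f f-hom =
    f-hom zero (suc zero) refl ∷ hom⇒walk xs (f ∘ suc) (isHom-tail plus xs {f} f-hom)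
  hom⇒walk (minus ∷ xs) f f-hom =
    f-hom (suc zero) zero refl ∷ hom⇒walk xs (f ∘ suc) (isHom-tail minus xs {f} f-hom)

  vertexAt-hom⇒walk : ∀ xs f (f-hom : IsHom (p xs) G f) a →
                      vertexAt (hom⇒walk xs f f-hom) (toℕ a) ≡ f a
  vertexAt-hom⇒walk xs           f f-hom zero    = refl
  vertexAt-hom⇒walk (plus  ∷ xs) f f-hom (suc a) =
    vertexAt-hom⇒walk xs (f ∘ suc) (isHom-tail plus xs {f} f-hom) a
  vertexAt-hom⇒walk (minus ∷ xs) f f-hom (suc a) =
    vertexAt-hom⇒walk xs (f ∘ suc) (isHom-tail minus xs {f} f-hom) a

  walk-isHom-prefix : ∀ {u xs w} (W : Walk G u xs w) ys (a b : V (p (xs ++ ys))) →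
                      toℕ a ≤ length xs → toℕ b ≤ length xs → E (p (xs ++ ys)) a b →
                      E G (vertexAt W (toℕ a)) (vertexAt W (toℕ b))
  walk-isHom-prefix {xs = plus  ∷ _} (a ∷ W) ys zero       (suc zero) _ _ _ = a
  walk-isHom-prefix {xs = minus ∷ _} (a ∷ W) ys (suc zero) zero       _ _ _ = a
  walk-isHom-prefix {xs = c ∷ xs} (a ∷ W) ys (suc i) (suc j) (s≤s i≤n) (s≤s j≤n) e =
    walk-isHom-prefix W ys i j i≤n j≤n (trans (sym (pathEdge-suc c (xs ++ ys) i j)) e)
  walk-isHom-prefix {xs = xs} W ys zero zero _ _ e = ⊥-elim (pathEdge-irrefl (xs ++ ys) e)

  p∖first⟶ : ∀ {c u xs w} → Walk G u xs w → p (c ∷ xs) ∖ zero ⟶ G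
  p∖first⟶ {c} {xs = xs} W = vertexAt W ∘ pred ∘ toℕ , hom
    where
    hom : ∀ a b → a ≢ zero → b ≢ zero → E (p (c ∷ xs)) a b →
          E G (vertexAt W (pred (toℕ a))) (vertexAt W (pred (toℕ b)))
    hom zero    _       a≢0 _   _ = ⊥-elim (a≢0 refl)
    hom (suc a) zero    _   b≢0 _ = ⊥-elim (b≢0 refl)
    hom (suc a) (suc b) _   _   e = walk-isHom W a b (trans (sym (pathEdge-suc c xs a b)) e)

  p∖last⟶ : ∀ {c u xs w} → Walk G u xs w → p (xs ++ c ∷ []) ∖ fromℕ (length (xs ++ c ∷ [])) ⟶ G
  p∖last⟶ {c} {xs = xs} W = vertexAt W ∘ toℕ , λ a b a≢N b≢N →
    walk-isHom-prefix W (c ∷ []) a b (below a a≢N) (below b b≢N)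
    where
    below : ∀ a → a ≢ fromℕ (length (xs ++ c ∷ [])) → toℕ a ≤ length xs
    below a a≢N = m<1+n⇒m≤n (subst (toℕ a <_) (trans (length-++ xs) (+-comm (length xs) 1))
      (≤∧≢⇒< (m<1+n⇒m≤n (toℕ<n a)) λ a≡N → a≢N (toℕ-injective (trans a≡N (sym (toℕ-fromℕ _))))))

arc-adjacent : ∀ xs c {a b} → Arc (p xs) c a b → toℕ b ≡ suc (toℕ a) ⊎ toℕ a ≡ suc (toℕ b)
arc-adjacent xs plus  e = pathEdge-adjacent xs e
arc-adjacent xs minus e = Sum.swap (pathEdge-adjacent xs e)

module _ {G H : Graph} (f : V G → V H) (f-hom : IsHom G H f) where

  mapArc : ∀ c {u v} → Arc G c u v → Arc H c (f u) (f v)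
  mapArc plus  a = f-hom _ _ a
  mapArc minus a = f-hom _ _ a

  mapʷ : ∀ {u xs w} → Walk G u xs w → Walk H (f u) xs (f w)
  mapʷ []      = []
  mapʷ (a ∷ W) = mapArc _ a ∷ mapʷ W

ascend : ∀ {G} → (∀ {a b : V G} → toℕ b ≡ suc (toℕ a) → E G a b) →
         ∀ m {a b : V G} → toℕ a + m ≡ toℕ b → Walk G a (replicate m plus) b
ascend succ zero {a} a+0≡b =
  subst (Walk _ a []) (toℕ-injective (trans (sym (+-identityʳ _)) a+0≡b)) []
ascend {G} succ (suc m) {a} {b} a+1+m≡b =
  succ (toℕ-fromℕ< a+1<n) ∷ ascend succ m (trans (cong (_+ m) (toℕ-fromℕ< a+1<n)) 1+a+m≡b)
  where
  1+a+m≡b : suc (toℕ a) + m ≡ toℕ b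
  1+a+m≡b = trans (sym (+-suc (toℕ a) m)) a+1+m≡b
  a+1<n : suc (toℕ a) < size G
  a+1<n = ≤-<-trans (≤-trans (m≤m+n (suc (toℕ a)) m) (≤-reflexive 1+a+m≡b)) (toℕ<n b)

-- Reachability and closed sets of vertices

module _ (G : Graph) where

  Reachable : Pred (V G) 0ℓ → List Sign → Pred (V G) 0ℓ
  Reachable S xs v = ∃ λ u → S u × Walk G u xs v

  arc? : ∀ c → Decidable₂ (Arc G c)
  arc? plus  u v = edge G u v Bool.≟ true
  arc? minus u v = edge G v u Bool.≟ true

  reachable? : ∀ {S} → Decidable S → ∀ xs → Decidable (Reachable S xs)
  reachable? S? [] v = map′ (λ Sv → v , Sv , []) (λ { (u , Su , []) → Su }) (S? v)
  reachable? {S} S? (c ∷ xs) v =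
    map′ (λ { (_ , (u , Su , a ∷ []) , W) → u , Su , a ∷ W })
         (λ { (u , Su , a ∷ W) → _ , (u , Su , a ∷ []) , W })
         (reachable? one-step? xs v)
    where
    one-step? : Decidable (Reachable S (c ∷ []))
    one-step? m = map′ (λ (u , Su , a) → u , Su , a ∷ [])
                       (λ { (u , Su , a ∷ []) → u , Su , a })
                       (any? λ u → S? u ×-dec arc? c u m)

module _ {n} (F : Subset n → Subset n) (F-inflationary : ∀ X → X ⊆ F X)
         (P : Subset n → Set) (P-F : ∀ {X} → P X → P (F X)) where

  postfixpoint : ∀ X → P X → ∃ λ Y → P Y × F Y ⊆ Y
  postfixpoint X = go X (⊃-wellFounded X)
    where
    go : ∀ X → Acc _⊃_ X → P X → ∃ λ Y → P Y × F Y ⊆ Y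
    go X (acc larger) PX with X ⊂? F X
    ... | yes X⊂FX = go (F X) (larger X⊂FX) (P-F PX)
    ... | no  X⊄FX = X , PX , λ {x} → closed x
      where
      closed : ∀ x → x ∈ F X → x ∈ X
      closed x x∈FX with x ∈? X
      ... | yes x∈X = x∈X
      ... | no  x∉X = ⊥-elim (X⊄FX (F-inflationary X , x , x∈FX , x∉X))

toSubset : ∀ {n} {P : Pred (Fin n) 0ℓ} → Decidable P → Subset n
toSubset P? = tabulate (does ∘ P?)

module _ {n} {P : Pred (Fin n) 0ℓ} (P? : Decidable P) {x : Fin n} where

  ∈-toSubset⁺ : P x → x ∈ toSubset P?
  ∈-toSubset⁺ Px = lookup⇒[]= x _ (trans (lookup∘tabulate (does ∘ P?) x) (dec-true (P? x) Px))

  ∈-toSubset⁻ : x ∈ toSubset P? → P x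
  ∈-toSubset⁻ x∈ = invert (subst (Reflects _)
    (trans (sym (lookup∘tabulate (does ∘ P?) x)) ([]=⇒lookup x∈)) (proof (P? x)))

module _ (q : ℕ → ℕ) (n : ℕ)
         (step : ∀ i → i < n → q (suc i) ≤ suc (q i) × q i ≤ suc (q (suc i))) where

  private
    lipschitz-+ : ∀ i d → i + d ≤ n → q (i + d) ≤ q i + d × q i ≤ q (i + d) + d
    lipschitz-+ i zero _ rewrite +-identityʳ i | +-identityʳ (q i) = ≤-refl , ≤-refl
    lipschitz-+ i (suc d) i+1+d≤n
      rewrite +-suc i d | +-suc (q i) d | +-suc (q (suc (i + d))) d
      with lipschitz-+ i d (≤-trans (n≤1+n _) i+1+d≤n) | step (i + d) i+1+d≤n
    ... | up , down | up₁ , down₁ = ≤-trans up₁ (s≤s up) , ≤-trans down (+-monoˡ-≤ d down₁)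

  lipschitz : ∀ {i j} → i ≤ n → j ≤ n → q j ≤ q i + ∣ i - j ∣
  lipschitz {i} {j} i≤n j≤n with ≤-total i j
  ... | inj₁ i≤j = subst₂ (λ k d → q k ≤ q i + d) (m+[n∸m]≡n i≤j) (sym (m≤n⇒∣m-n∣≡n∸m i≤j))
    (proj₁ (lipschitz-+ i (j ∸ i) (subst (_≤ n) (sym (m+[n∸m]≡n i≤j)) j≤n)))
  ... | inj₂ j≤i = subst₂ (λ k d → q j ≤ q k + d) (m+[n∸m]≡n j≤i) (sym (m≤n⇒∣n-m∣≡n∸m j≤i))
    (proj₂ (lipschitz-+ j (i ∸ j) (subst (_≤ n) (sym (m+[n∸m]≡n j≤i)) i≤n)))

adjacent⇒≤1 : ∀ {m n} → m ≡ suc n ⊎ n ≡ suc m → m ≤ suc n × n ≤ suc m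
adjacent⇒≤1 (inj₁ refl) = ≤-refl , ≤-trans (n≤1+n _) (n≤1+n _)
adjacent⇒≤1 (inj₂ refl) = ≤-trans (n≤1+n _) (n≤1+n _) , ≤-refl

extremes : ∀ {a b n} → a ≤ n → b ≤ n → n ≤ ∣ a - b ∣ → (a ≡ 0 × b ≡ n) ⊎ (a ≡ n × b ≡ 0)
extremes {a} {b} {n} a≤n b≤n n≤∣a-b∣ = Sum.[
    (λ a≤b → inj₁ (ends a≤b b≤n (subst (n ≤_) (m≤n⇒∣m-n∣≡n∸m a≤b) n≤∣a-b∣))) ,
    (λ b≤a → inj₂ (Prod.swap (ends b≤a a≤n (subst (n ≤_) (m≤n⇒∣n-m∣≡n∸m b≤a) n≤∣a-b∣)))) ]′
  (≤-total a b)
  where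
  ends : ∀ {i j} → i ≤ j → j ≤ n → n ≤ j ∸ i → i ≡ 0 × j ≡ n
  ends {i} {j} i≤j j≤n n≤j∸i =
    n≤0⇒n≡0 (+-cancelʳ-≤ (j ∸ i) i 0
      (≤-trans (≤-reflexive (m+[n∸m]≡n i≤j)) (≤-trans j≤n n≤j∸i))) ,
    ≤-antisym j≤n (≤-trans n≤j∸i (m∸n≤m j i))

largest≤ : ∀ {P : Pred ℕ 0ℓ} → Decidable P → P 0 → ∀ m →
           ∃ λ j → j ≤ m × P j × (∀ {i} → i ≤ m → P i → i ≤ j)
largest≤ P? P0 zero = 0 , z≤n , P0 , λ i≤0 _ → i≤0
largest≤ {P} P? P0 (suc m) with P? (suc m)
... | yes P[1+m] = suc m , ≤-refl , P[1+m] , λ i≤1+m _ → i≤1+m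
... | no  ¬P[1+m] with largest≤ P? P0 m
...   | j , j≤m , Pj , max = j , m≤n⇒m≤1+n j≤m , Pj , below
  where
  below : ∀ {i} → i ≤ suc m → P i → i ≤ j
  below i≤1+m Pi with m≤n⇒m<n∨m≡n i≤1+m
  ... | inj₁ i<1+m = max (m<1+n⇒m≤n i<1+m) Pi
  ... | inj₂ refl  = ⊥-elim (¬P[1+m] Pi)

concat-replicate-comm : ∀ {A : Set} k (xs : List A) →
                        concat (replicate k xs) ++ xs ≡ xs ++ concat (replicate k xs)
concat-replicate-comm zero    xs = sym (++-identityʳ xs)
concat-replicate-comm (suc k) xs =
  trans (++-assoc xs _ xs) (cong (xs ++_) (concat-replicate-comm k xs))

block : ℕ → List Sign
block s = minus ∷ replicate (s ∸ 1) plus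

blocks : ℕ → ℕ → List Sign
blocks s k = concat (replicate k (block s))

word : ℕ → ℕ → List Sign
word s k = replicate s plus ++ blocks s k ++ plus ∷ []

module _ {s : ℕ} where

  -- Its boolean is definitionally edge (D s) a b, which is what E-D⁺ and E-D⁻ rely on.
  D-edge? : (a b : V (D s)) → Dec (toℕ a < toℕ b × ¬ (toℕ a ≡ 0 × toℕ b ≡ s))
  D-edge? a b = (toℕ a <? toℕ b) ×-dec ¬? ((toℕ a ≟ 0) ×-dec (toℕ b ≟ s))

  E-D⁺ : ∀ {a b : V (D s)} → toℕ a < toℕ b → ¬ (toℕ a ≡ 0 × toℕ b ≡ s) → E (D s) a b
  E-D⁺ {a} {b} a<b ¬ends = dec-true (D-edge? a b) (a<b , ¬ends)

  E-D⁻ : ∀ {a b : V (D s)} → E (D s) a b → toℕ a < toℕ b × ¬ (toℕ a ≡ 0 × toℕ b ≡ s)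
  E-D⁻ {a} {b} e = invert (subst (Reflects _) e (proof (D-edge? a b)))

  E-D-succ : 2 ≤ s → ∀ {a b : V (D s)} → toℕ b ≡ suc (toℕ a) → E (D s) a b
  E-D-succ 2≤s b≡1+a = E-D⁺ (≤-reflexive (sym b≡1+a))
    λ (a≡0 , b≡s) → 1+n≰n (subst (2 ≤_) (trans (sym b≡s) (trans b≡1+a (cong suc a≡0))) 2≤s)

  D-≤top : ∀ (v : V (D s)) → toℕ v ≤ s
  D-≤top v = m<1+n⇒m≤n (toℕ<n v)

  D-ascent : ∀ {m} {u w : V (D s)} → Walk (D s) u (replicate m plus) w → toℕ u + m ≤ toℕ w
  D-ascent {zero}  []          = ≤-reflexive (+-identityʳ _)
  D-ascent {suc m} {u} (a ∷ W) = begin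
    toℕ u + suc m    ≡⟨ +-suc (toℕ u) m ⟩
    suc (toℕ u) + m  ≤⟨ +-monoˡ-≤ m (proj₁ (E-D⁻ a)) ⟩
    _                ≤⟨ D-ascent W ⟩
    _                ∎
    where open ≤-Reasoning

  -- The top vertex can only be left backwards to some vertex q ≥ 1, from which the
  -- s - 1 forward steps of the block lead back to the top.
  D-top-blocks : ∀ k {u w : V (D s)} → toℕ u ≡ s → Walk (D s) u (blocks s k) w → toℕ w ≡ s
  D-top-blocks zero    u≡s [] = u≡s
  D-top-blocks (suc k) u≡s W with splitʷ (block s) W
  ... | v , (_∷_ {v = q} q→u W₁) , W₂ = D-top-blocks k (≤-antisym (D-≤top v) s≤v) W₂
    where
    s≤v : s ≤ toℕ v
    s≤v = begin
      s                  ≤⟨ m≤n+m∸n s 1 ⟩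
      1 + (s ∸ 1)        ≤⟨ +-monoˡ-≤ (s ∸ 1) (n≢0⇒n>0 λ q≡0 → proj₂ (E-D⁻ q→u) (q≡0 , u≡s)) ⟩
      toℕ q + (s ∸ 1)    ≤⟨ D-ascent W₁ ⟩
      toℕ v              ∎
      where open ≤-Reasoning

  D-noWalk : ∀ k {u w : V (D s)} → ¬ Walk (D s) u (word s k) w
  D-noWalk k {u} {w} W with splitʷ (replicate s plus) W
  ... | m , W₁ , W₂ with splitʷ (blocks s k) W₂
  ... | m′ , W₃ , (m′→w ∷ []) = <⇒≱ (proj₁ (E-D⁻ m′→w)) (subst (toℕ w ≤_) (sym m′≡s) (D-≤top w))
    where
    m≡s : toℕ m ≡ s
    m≡s = ≤-antisym (D-≤top m) (≤-trans (m≤n+m s (toℕ u)) (D-ascent W₁))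
    m′≡s : toℕ m′ ≡ s
    m′≡s = D-top-blocks k m≡s W₃

P↛D : ∀ s k → ¬ (P s k ⟶ D s)
P↛D s k (f , f-hom) = D-noWalk k (hom⇒walk (word s k) f f-hom)

-- Along the successor walks 0 ⇝ i ⇝ s the image of i can climb neither less nor more than i does.
D-endo-id : ∀ {s} → 2 ≤ s → ∀ f → IsHom (D s) (D s) f → ∀ i → f i ≡ i
D-endo-id {s} 2≤s f f-hom i = toℕ-injective (≤-antisym fi≤i i≤fi)
  where
  i≤s : toℕ i ≤ s
  i≤s = D-≤top i
  i≤fi : toℕ i ≤ toℕ (f i)
  i≤fi = ≤-trans (m≤n+m (toℕ i) _)
                 (D-ascent (mapʷ f f-hom (ascend (E-D-succ 2≤s) (toℕ i) {zero} refl)))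
  fi≤i : toℕ (f i) ≤ toℕ i
  fi≤i = +-cancelʳ-≤ (s ∸ toℕ i) _ _ (begin
    toℕ (f i) + (s ∸ toℕ i)   ≤⟨ D-ascent (mapʷ f f-hom (ascend (E-D-succ 2≤s) (s ∸ toℕ i)
                                   {i} {fromℕ s} (trans (m+[n∸m]≡n i≤s) (sym (toℕ-fromℕ s))))) ⟩
    toℕ (f (fromℕ s))         ≤⟨ D-≤top _ ⟩
    s                         ≡⟨ m+[n∸m]≡n i≤s ⟨
    toℕ i + (s ∸ toℕ i)       ∎)
    where open ≤-Reasoning

-- Duality

module Duality (r : ℕ) (G : Graph) where

  s : ℕ
  s = suc (suc r)

  -- The vertices that every homomorphism G → D s must send to the top vertex s.
  Forced : Pred (V G) 0ℓ
  Forced v = ∃ λ k → Reachable G U (replicate s plus ++ blocks s k) v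

  forced⟶ : ∀ {v w} → Forced v → E G v w → Σ ℕ λ k → P s k ⟶ G
  forced⟶ {w = w} (k , u , _ , W) v→w =
    k , walk⇒⟶ (subst (λ xs → Walk G u xs w)
                       (++-assoc (replicate s plus) (blocks s k) (plus ∷ [])) (W ++ʷ (v→w ∷ [])))

  ForcedSet : Subset (size G) → Set
  ForcedSet X = ∀ {v} → v ∈ X → Forced v

  Extension : Subset (size G) → Pred (V G) 0ℓ
  Extension X v = v ∈ X ⊎ (Reachable G U (replicate s plus) v ⊎ Reachable G (_∈ X) (block s) v)

  extension? : ∀ X → Decidable (Extension X)
  extension? X v =
    v ∈? X ⊎-dec (reachable? G U? (replicate s plus) v ⊎-dec reachable? G (_∈? X) (block s) v)

  extend : Subset (size G) → Subset (size G)
  extend X = toSubset (extension? X)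

  extend-forced : ∀ {X} → ForcedSet X → ForcedSet (extend X)
  extend-forced {X} X-forced {v} v∈ with ∈-toSubset⁻ (extension? X) v∈
  ... | inj₁ v∈X                 = X-forced v∈X
  ... | inj₂ (inj₁ (u , _ , W))  =
    0 , u , tt , subst (λ xs → Walk G u xs v) (sym (++-identityʳ (replicate s plus))) W
  ... | inj₂ (inj₂ (t , t∈X , W)) with X-forced t∈X
  ...   | k , u , _ , W₀ = suc k , u , tt , subst (λ xs → Walk G u xs v) blocks-snoc (W₀ ++ʷ W)
    where
    blocks-snoc : (replicate s plus ++ blocks s k) ++ block s ≡ replicate s plus ++ blocks s (suc k)
    blocks-snoc = trans (++-assoc (replicate s plus) (blocks s k) (block s))
                        (cong (replicate s plus ++_) (concat-replicate-comm k (block s)))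

  -- Opaque, so that type checking never unfolds the well-founded fixpoint computation.
  opaque
    fixed : ∃ λ R → ForcedSet R × extend R ⊆ R
    fixed = postfixpoint extend (λ X x∈X → ∈-toSubset⁺ (extension? X) (inj₁ x∈X))
                         ForcedSet extend-forced ⊥ (⊥-elim ∘ ∉⊥)

  R : Subset (size G)
  R = proj₁ fixed

  R-forced : ForcedSet R
  R-forced = proj₁ (proj₂ fixed)

  R-top : ∀ {v} → Reachable G U (replicate s plus) v → v ∈ R
  R-top h = proj₂ (proj₂ fixed) (∈-toSubset⁺ (extension? R) (inj₂ (inj₁ h)))

  R-block : ∀ {v} → Reachable G (_∈ R) (block s) v → v ∈ R
  R-block h = proj₂ (proj₂ fixed) (∈-toSubset⁺ (extension? R) (inj₂ (inj₂ h)))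

  -- Level j v: every homomorphism G → D s sends v to a vertex ≥ j.
  Level : ℕ → Pred (V G) 0ℓ
  Level zero    v = ⊤
  Level (suc j) v = Reachable G U (replicate (suc j) plus) v
                  ⊎ Reachable G (_∈ R) (minus ∷ replicate j plus) v

  level? : ∀ j → Decidable (Level j)
  level? zero    v = yes tt
  level? (suc j) v = reachable? G U? _ v ⊎-dec reachable? G (_∈? R) _ v

  level-step : ∀ j {v w} → Level j v → E G v w → Level (suc j) w
  level-step zero    {v} _                    e = inj₁ (v , tt , e ∷ [])
  level-step (suc j) (inj₁ (u , _ , W))       e = inj₁ (u , tt , snoc⁺ W e)
  level-step (suc j) (inj₂ (t , t∈R , a ∷ W)) e = inj₂ (t , t∈R , a ∷ snoc⁺ W e)

  level-top : ∀ {v} → Level s v → v ∈ R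
  level-top (inj₁ h) = R-top h
  level-top (inj₂ h) = R-block h

  private
    largestLevel : ∀ v →
                   ∃ λ j → j ≤ suc r × Level j v × (∀ {i} → i ≤ suc r → Level i v → i ≤ j)
    largestLevel v = largest≤ (λ j → level? j v) tt (suc r)

  level : V G → ℕ
  level v = proj₁ (largestLevel v)

  level-≤ : ∀ v → level v ≤ suc r
  level-≤ v = proj₁ (proj₂ (largestLevel v))

  level-holds : ∀ v → Level (level v) v
  level-holds v = proj₁ (proj₂ (proj₂ (largestLevel v)))

  level-max : ∀ {i} v → i ≤ suc r → Level i v → i ≤ level v
  level-max v = proj₂ (proj₂ (proj₂ (largestLevel v)))

  levelVertex : V G → V (D s)
  levelVertex v = fromℕ< (s≤s (m≤n⇒m≤1+n (level-≤ v)))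

  toℕ-levelVertex : ∀ v → toℕ (levelVertex v) ≡ level v
  toℕ-levelVertex v = toℕ-fromℕ< _

  height : V G → V (D s)
  height v with v ∈? R
  ... | yes _ = fromℕ s
  ... | no  _ = levelVertex v

  module _ (R-sink : ∀ {v w} → v ∈ R → ¬ E G v w) where

    height-isHom : IsHom G (D s) height
    height-isHom u v e with u ∈? R | v ∈? R
    ... | yes u∈R | _       = ⊥-elim (R-sink u∈R e)
    ... | no  _   | yes v∈R = E-D⁺ below-top
          (λ (u≡0 , _) → 1+n≰n (subst (1 ≤_) (trans (sym (toℕ-levelVertex u)) u≡0) 1≤level))
      where
      below-top : toℕ (levelVertex u) < toℕ (fromℕ s)
      below-top = subst₂ _<_ (sym (toℕ-levelVertex u)) (sym (toℕ-fromℕ s)) (s≤s (level-≤ u))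
      1≤level : 1 ≤ level u
      1≤level = level-max u (s≤s z≤n) (inj₂ (v , v∈R , e ∷ []))
    ... | no  _   | no  v∉R with suc (level u) ≤? suc r
    ...   | yes 1+lu≤1+r = E-D⁺ (subst₂ _<_ (sym (toℕ-levelVertex u)) (sym (toℕ-levelVertex v)) lu<lv)
          (λ (_ , v≡s) → 1+n≰n (subst (_≤ suc r) (trans (sym (toℕ-levelVertex v)) v≡s) (level-≤ v)))
      where
      lu<lv : level u < level v
      lu<lv = level-max v 1+lu≤1+r (level-step _ (level-holds u) e)
    ...   | no  1+lu≰1+r =
          ⊥-elim (v∉R (level-top (subst (λ j → Level j v) 1+lu≡s (level-step _ (level-holds u) e))))
      where
      1+lu≡s : suc (level u) ≡ s
      1+lu≡s = cong suc (≤-antisym (level-≤ u) (m<1+n⇒m≤n (≰⇒> 1+lu≰1+r)))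

  result : (Σ ℕ λ k → P s k ⟶ G) ⊎ (G ⟶ D s)
  result with any? (λ v → v ∈? R ×-dec any? (λ w → edge G v w Bool.≟ true))
  ... | yes (v , v∈R , w , v→w) = inj₁ (forced⟶ (R-forced v∈R) v→w)
  ... | no  no-exit            =
    inj₂ (height , height-isHom λ v∈R v→w → no-exit (_ , v∈R , _ , v→w))

D-isCore : ∀ s → 2 ≤ s → IsCore (D s)
D-isCore s 2≤s f f-hom = ≗id⇒isIso f (D-endo-id 2≤s f f-hom)

duality : ∀ s → 2 ≤ s → ∀ G → (Σ ℕ λ k → P s k ⟶ G) ⊎ (G ⟶ D s)
duality (suc (suc r)) (s≤s (s≤s _)) G = Duality.result r G

-- Homomorphisms between the paths

module _ (x y : List Sign) (f : V (p x) → V (p y)) (f-hom : IsHom (p x) (p y) f) where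

  pathHom-lipschitz : ∀ a b → toℕ (f b) ≤ toℕ (f a) + ∣ toℕ a - toℕ b ∣
  pathHom-lipschitz a b = subst₂ (λ m n → n ≤ m + ∣ toℕ a - toℕ b ∣) (vertex a) (vertex b)
    (lipschitz q (length x) steps (m<1+n⇒m≤n (toℕ<n a)) (m<1+n⇒m≤n (toℕ<n b)))
    where
    W : Walk (p y) (f zero) x (f (fromℕ (length x)))
    W = hom⇒walk x f f-hom
    q : ℕ → ℕ
    q = toℕ ∘ vertexAt W
    vertex : ∀ a → q (toℕ a) ≡ toℕ (f a)
    vertex a = cong toℕ (vertexAt-hom⇒walk x f f-hom a)
    steps : ∀ i → i < length x → q (suc i) ≤ suc (q i) × q i ≤ suc (q (suc i))
    steps i i<n = let (c , arc) = walk-arc W i i<n in adjacent⇒≤1 (arc-adjacent y c arc)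

  pathHom-span : ∀ a b → f a ≡ zero → f b ≡ fromℕ (length y) → length y ≤ ∣ toℕ a - toℕ b ∣
  pathHom-span a b fa≡0 fb≡N = subst₂ (λ m n → n ≤ m + ∣ toℕ a - toℕ b ∣)
    (cong toℕ fa≡0) (trans (cong toℕ fb≡N) (toℕ-fromℕ _)) (pathHom-lipschitz a b)

pathEndo-id : ∀ x (f : V (p x) → V (p x)) → IsHom (p x) (p x) f →
              f zero ≡ zero → f (fromℕ (length x)) ≡ fromℕ (length x) → ∀ a → f a ≡ a
pathEndo-id x f f-hom f0≡0 fN≡N a = toℕ-injective (≤-antisym fa≤a a≤fa)
  where
  a≤n : toℕ a ≤ length x
  a≤n = m<1+n⇒m≤n (toℕ<n a)
  fa≤a : toℕ (f a) ≤ toℕ a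
  fa≤a = subst (λ m → toℕ (f a) ≤ m + toℕ a) (cong toℕ f0≡0)
               (pathHom-lipschitz x x f f-hom zero a)
  a≤fa : toℕ a ≤ toℕ (f a)
  a≤fa = +-cancelʳ-≤ (length x ∸ toℕ a) _ _ (begin
    toℕ a + (length x ∸ toℕ a)          ≡⟨ m+[n∸m]≡n a≤n ⟩
    length x                            ≡⟨ toℕ-fromℕ _ ⟨
    toℕ (fromℕ (length x))              ≡⟨ cong toℕ fN≡N ⟨
    toℕ (f (fromℕ (length x)))          ≤⟨ pathHom-lipschitz x x f f-hom a _ ⟩
    toℕ (f a) + ∣ toℕ a - toℕ (fromℕ (length x)) ∣
                                        ≡⟨ cong (λ m → toℕ (f a) + ∣ toℕ a - m ∣) (toℕ-fromℕ _) ⟩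
    toℕ (f a) + ∣ toℕ a - length x ∣    ≡⟨ cong (toℕ (f a) +_) (m≤n⇒∣m-n∣≡n∸m a≤n) ⟩
    toℕ (f a) + (length x ∸ toℕ a)      ∎)
    where open ≤-Reasoning

word≡ : ∀ s k → word s k ≡ (replicate s plus ++ blocks s k) ++ plus ∷ []
word≡ s k = sym (++-assoc (replicate s plus) (blocks s k) (plus ∷ []))

P-last-sink : ∀ s k b → ¬ E (P s k) (fromℕ _) b
P-last-sink s k = subst (λ xs → ∀ b → ¬ E (p xs) (fromℕ (length xs)) b) (sym (word≡ s k))
                        (pathEdge-last (replicate s plus ++ blocks s k))

length-blocks : ∀ s k → length (blocks s k) ≡ k * length (block s)
length-blocks s zero    = refl
length-blocks s (suc k) =
  trans (length-++ (block s)) (cong (length (block s) +_) (length-blocks s k))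

length-word-< : ∀ s {k l} → k < l → length (word s k) < length (word s l)
length-word-< s {k} {l} k<l = subst₂ _<_ (sym (length-word k)) (sym (length-word l))
  (+-monoʳ-< (length (replicate s plus)) (+-monoˡ-< 1
    (subst₂ _<_ (sym (length-blocks s k)) (sym (length-blocks s l))
            (*-monoˡ-< (length (block s)) k<l))))
  where
  length-word : ∀ k → length (word s k) ≡ length (replicate s plus) + (length (blocks s k) + 1)
  length-word k = trans (length-++ (replicate s plus))
                        (cong (length (replicate s plus) +_) (length-++ (blocks s k)))

directedPath : ℕ → Graph
directedPath n = record { size = suc n ; edge = λ i j → does (suc (toℕ i) ≟ toℕ j) }

module _ {n : ℕ} {a b : V (directedPath n)} where

  E-dir⁺ : toℕ b ≡ suc (toℕ a) → E (directedPath n) a b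
  E-dir⁺ b≡1+a = dec-true (suc (toℕ a) ≟ toℕ b) (sym b≡1+a)

  E-dir⁻ : E (directedPath n) a b → toℕ b ≡ suc (toℕ a)
  E-dir⁻ e = sym (invert (subst (Reflects _) e (proof (suc (toℕ a) ≟ toℕ b))))

dir-ascent : ∀ {n m} {a b : V (directedPath n)} →
             Walk (directedPath n) a (replicate m plus) b → toℕ b ≡ toℕ a + m
dir-ascent {m = zero}      []      = sym (+-identityʳ _)
dir-ascent {m = suc m} {a} (e ∷ W) =
  trans (dir-ascent W) (trans (cong (_+ m) (E-dir⁻ e)) (sym (+-suc (toℕ a) m)))

module Paths (r : ℕ) where

  s : ℕ
  s = suc (suc r)

  private
    succ : ∀ {a b : V (D s)} → toℕ b ≡ suc (toℕ a) → E (D s) a b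
    succ = E-D-succ (s≤s (s≤s z≤n))

    top mid : V (D s)
    top = fromℕ s
    mid = fromℕ< {suc r} (s≤s (n≤1+n (suc r)))

    toℕ-mid : toℕ mid ≡ suc r
    toℕ-mid = toℕ-fromℕ< (s≤s (n≤1+n (suc r)))

    block-cycle : ∀ {q a : V (D s)} → E (D s) q a → toℕ q + suc r ≡ toℕ a →
                  Walk (D s) a (block s) a
    block-cycle q→a q+s-1≡a = q→a ∷ ascend succ (suc r) q+s-1≡a

  P∖first⟶D : ∀ l → P s l ∖ zero ⟶ D s
  P∖first⟶D l = p∖first⟶ {c = plus} {w = top} (ascend succ (suc r) {zero} {mid} (sym toℕ-mid)
                  ++ʷ (repeatʷ l (block-cycle {zero} {mid} 0→mid (sym toℕ-mid))
                  ++ʷ (succ {mid} {top} (trans (toℕ-fromℕ s) (cong suc (sym toℕ-mid))) ∷ [])))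
    where
    0→mid : E (D s) zero mid
    0→mid = E-D⁺ {a = zero} {mid} (subst (0 <_) (sym toℕ-mid) (s≤s z≤n))
                 λ (_ , mid≡s) → 1+n≢n (trans (sym mid≡s) toℕ-mid)

  P∖last⟶D : ∀ l → P s l ∖ fromℕ _ ⟶ D s
  P∖last⟶D l = subst (λ xs → p xs ∖ fromℕ (length xs) ⟶ D s) (sym (word≡ s l))
    (p∖last⟶ (ascend succ s {zero} {top} (sym (toℕ-fromℕ s))
               ++ʷ repeatʷ l (block-cycle {suc zero} {top} 1→top (sym (toℕ-fromℕ s)))))
    where
    1→top : E (D s) (suc zero) top
    1→top = E-D⁺ {a = suc zero} {top} (subst (1 <_) (sym (toℕ-fromℕ s)) (s≤s (s≤s z≤n))) λ ()

  P⟶P-ends : ∀ k l (h : P s k ⟶ P s l) →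
             (∃ λ a → proj₁ h a ≡ zero) × (∃ λ b → proj₁ h b ≡ fromℕ _)
  P⟶P-ends k l h = ⟶-hits {H = D s} h zero (P∖first⟶D l) (P↛D s k) ,
                   ⟶-hits {H = D s} h (fromℕ _) (P∖last⟶D l) (P↛D s k)

  P⟶P-length : ∀ k l → P s k ⟶ P s l → length (word s l) ≤ length (word s k)
  P⟶P-length k l h@(f , f-hom) with P⟶P-ends k l h
  ... | (a , fa≡0) , (b , fb≡N) =
    ≤-trans (pathHom-span (word s k) (word s l) f f-hom a b fa≡0 fb≡N)
            (≤-trans (∣m-n∣≤m⊔n (toℕ a) (toℕ b))
                     (⊔-lub (m<1+n⇒m≤n (toℕ<n a)) (m<1+n⇒m≤n (toℕ<n b))))

  P-isCore : ∀ k → IsCore (P s k)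
  P-isCore k f f-hom with P⟶P-ends k k (f , f-hom)
  ... | (a , fa≡0) , (b , fb≡N)
    with extremes (m<1+n⇒m≤n (toℕ<n a)) (m<1+n⇒m≤n (toℕ<n b))
                  (pathHom-span (word s k) (word s k) f f-hom a b fa≡0 fb≡N)
  ... | inj₁ (a≡0 , b≡N) = ≗id⇒isIso f (pathEndo-id (word s k) f f-hom
          (subst (λ a → f a ≡ zero) (toℕ-injective a≡0) fa≡0)
          (subst (λ b → f b ≡ fromℕ _) (toℕ-injective (trans b≡N (sym (toℕ-fromℕ _)))) fb≡N))
  ... | inj₂ (_ , b≡0) = ⊥-elim (P-last-sink s k (f (suc zero))
          (subst (λ v → E (P s k) v (f (suc zero))) f0≡N (f-hom zero (suc zero) refl)))
    where
    f0≡N : f zero ≡ fromℕ _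
    f0≡N = subst (λ b → f b ≡ fromℕ _) (toℕ-injective b≡0) fb≡N

  dir-blocks : ∀ {n} k {a b : V (directedPath n)} →
               Walk (directedPath n) a (blocks s k) b → toℕ b ≡ toℕ a + k * r
  dir-blocks zero    []         = sym (+-identityʳ _)
  dir-blocks (suc k) {a} {b} W with splitʷ (block s) W
  ... | m , (_∷_ {v = q} q→a W₁) , W₂ = begin
    toℕ b                     ≡⟨ dir-blocks k W₂ ⟩
    toℕ m + k * r             ≡⟨ cong (_+ k * r) (dir-ascent W₁) ⟩
    toℕ q + suc r + k * r     ≡⟨ cong (_+ k * r) (+-suc (toℕ q) r) ⟩
    suc (toℕ q) + r + k * r   ≡⟨ cong (λ h → h + r + k * r) (E-dir⁻ q→a) ⟨
    toℕ a + r + k * r         ≡⟨ +-assoc (toℕ a) r (k * r) ⟩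
    toℕ a + suc k * r         ∎
    where open ≡-Reasoning

  dir-blocks-walk : ∀ {n} k c {a b : V (directedPath n)} → toℕ a ≡ suc c →
                    toℕ a + k * r ≡ toℕ b → Walk (directedPath n) a (blocks s k) b
  dir-blocks-walk zero c _ a+0≡b = ascend E-dir⁺ zero a+0≡b
  dir-blocks-walk {n} (suc k) c {a} {b} a≡1+c a+[1+k]r≡b =
    (q→a ∷ ascend E-dir⁺ (suc r) q+1+r≡a′) ++ʷ dir-blocks-walk k (c + r) a′≡1+c+r a′+kr≡b
    where
    b<n : toℕ b < suc n
    b<n = toℕ<n b
    a+r≤b : toℕ a + r ≤ toℕ b
    a+r≤b = ≤-trans (+-monoʳ-≤ (toℕ a) (m≤m+n r (k * r))) (≤-reflexive a+[1+k]r≡b)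
    q a′ : V (directedPath n)
    q  = fromℕ< (<-trans (≤-trans (≤-reflexive (sym a≡1+c)) (≤-trans (m≤m+n _ r) a+r≤b)) b<n)
    a′ = fromℕ< (≤-<-trans a+r≤b b<n)
    q→a : E (directedPath n) q a
    q→a = E-dir⁺ (trans a≡1+c (cong suc (sym (toℕ-fromℕ< _))))
    q+1+r≡a′ : toℕ q + suc r ≡ toℕ a′
    q+1+r≡a′ = trans (cong (_+ suc r) (toℕ-fromℕ< _))
                (trans (+-suc c r) (trans (cong (_+ r) (sym a≡1+c)) (sym (toℕ-fromℕ< _))))
    a′≡1+c+r : toℕ a′ ≡ suc (c + r)
    a′≡1+c+r = trans (toℕ-fromℕ< _) (cong (_+ r) a≡1+c)
    a′+kr≡b : toℕ a′ + k * r ≡ toℕ b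
    a′+kr≡b = trans (cong (_+ k * r) (toℕ-fromℕ< _))
                    (trans (+-assoc (toℕ a) r (k * r)) a+[1+k]r≡b)

  P⟶directedPath : ∀ l → P s l ⟶ directedPath (suc (s + l * r))
  P⟶directedPath l = walk⇒⟶ {w = top′}
    (ascend E-dir⁺ s {zero} {v-s} (sym toℕ-v-s)
     ++ʷ (dir-blocks-walk l (suc r) {v-s} {v-end} toℕ-v-s
            (trans (cong (_+ l * r) toℕ-v-s) (sym toℕ-v-end))
     ++ʷ (E-dir⁺ {a = v-end} {top′} (trans (toℕ-fromℕ _) (cong suc (sym toℕ-v-end))) ∷ [])))
    where
    v-s<n : s < suc (suc (s + l * r))
    v-s<n = s≤s (m≤n⇒m≤1+n (m≤m+n s (l * r)))
    v-end<n : s + l * r < suc (suc (s + l * r))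
    v-end<n = s≤s (n≤1+n (s + l * r))
    v-s v-end top′ : V (directedPath (suc (s + l * r)))
    v-s   = fromℕ< v-s<n
    v-end = fromℕ< v-end<n
    top′  = fromℕ _
    toℕ-v-s : toℕ v-s ≡ s
    toℕ-v-s = toℕ-fromℕ< v-s<n
    toℕ-v-end : toℕ v-end ≡ s + l * r
    toℕ-v-end = toℕ-fromℕ< v-end<n

  directedPath-height : ∀ k {n} → P s k ⟶ directedPath n → s + k * r < n
  directedPath-height k {n} (f , f-hom) with hom⇒walk (word s k) f f-hom
  ... | W with splitʷ (replicate s plus) W
  ... | m , W₁ , W₂ with splitʷ (blocks s k) W₂
  ... | m′ , W₃ , (m′→b ∷ []) = begin-strict
    s + k * r                          ≤⟨ +-monoˡ-≤ (k * r) (m≤n+m s (toℕ (f zero))) ⟩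
    toℕ (f zero) + s + k * r           ≡⟨ cong (_+ k * r) (dir-ascent W₁) ⟨
    toℕ m + k * r                      ≡⟨ dir-blocks k W₃ ⟨
    toℕ m′                             <⟨ ≤-reflexive (sym (E-dir⁻ m′→b)) ⟩
    toℕ (f (fromℕ _))                  ≤⟨ m<1+n⇒m≤n (toℕ<n _) ⟩
    n                                  ∎
    where open ≤-Reasoning

  P⟶P-height : ∀ k l → P s k ⟶ P s l → k * r ≤ l * r
  P⟶P-height k l h = +-cancelˡ-≤ s _ _ (m<1+n⇒m≤n
    (directedPath-height k (⟶-trans {C = directedPath _} h (P⟶directedPath l))))

P-isCore : ∀ s → 2 ≤ s → ∀ k → IsCore (P s k)
P-isCore (suc (suc r)) (s≤s (s≤s _)) = Paths.P-isCore r

P-antichain : ∀ s → 3 ≤ s → ∀ k l → k ≢ l → ¬ (P s k ⟶ P s l)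
P-antichain (suc (suc (suc r))) (s≤s (s≤s (s≤s _))) k l k≢l h with <-cmp k l
... | tri< k<l _ _ =
  <⇒≱ (length-word-< (suc (suc (suc r))) k<l) (Paths.P⟶P-length (suc r) k l h)
... | tri≈ _ k≡l _ = k≢l k≡l
... | tri> _ _ l<k = <⇒≱ l<k (*-cancelʳ-≤ k l (suc r) (Paths.P⟶P-height (suc r) k l h))

mainTheorem6 : (s : ℕ) → 3 ≤ s →
    ((G : Graph) →
      ((Σ ℕ λ k → P s k ⟶ G) ⊎ (G ⟶ D s))
      × ¬ ((Σ ℕ λ k → P s k ⟶ G) × (G ⟶ D s)))
    × ((k l : ℕ) → ¬ k ≡ l → ¬ (P s k ⟶ P s l))
    × ((k : ℕ) → IsCore (P s k))
    × IsCore (D s)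
mainTheorem6 s 3≤s =
    (λ G → duality s 2≤s G , λ ((k , P⟶G) , G⟶D) → P↛D s k (⟶-trans {C = D s} P⟶G G⟶D))
  , P-antichain s 3≤s
  , P-isCore s 2≤s
  , D-isCore s 2≤s
  where
  2≤s : 2 ≤ s
  2≤s = ≤-trans (n≤1+n 2) 3≤s
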